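{- Let $G=(V,E)$ be a directed graph, $s\neq t$ vertices, $k$ a positive integer and $(u,v)\in E$. Let $0\le k_f\le k-1$ and $k_b=k-k_f-1$. If $EV^\ast_{k_b}(v,t)$ does not exist, then $EV^\ast_l(v,t)$ does not exist for any $l<k_b$. If $EV^\ast_{k_b}(v,t)$ and $EV^\ast_{k_f}(s,u)$ exist and $EV^\ast_{k_f}(s,u)\cap EV^\ast_{k_b}(v,t)\neq\emptyset$, then $EV^\ast_{k_f}(s,u)\cap EV^\ast_l(v,t)\neq\emptyset$ for every $l<k_b$ for which $EV^\ast_l(v,t)$ exists.
   Context: A path from $x$ to $y$ is a vertex sequence $x=v_0,\ldots,v_l=y$ with $(v_{i-1},v_i)\in E$; its length is $l$ (length $0$ allowed); $V(p)$ is its vertex set; it is simple if its vertices are pairwise distinct. $P_l^\ast(x,y)$ is the set of simple paths from $x$ to $y$ of length at most $l$. Essential vertices: $EV_l^\ast(s,u)=\bigcap\{V(p): p\in P_l^\ast(s,u),\ t\notin V(p)\}$ and $EV_l^\ast(v,t)=\bigcap\{V(p): p\in P_l^\ast(v,t),\ s\notin V(p)\}$; $EV_l^\ast(s,u)$ exists iff some $p\in P_l^\ast(s,u)$ has $t\notin V(p)$, and $EV_l^\ast(v,t)$ exists iff some $p\in P_l^\ast(v,t)$ has $s\notin V(p)$. -}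

module Defs where

open import Data.Nat using (ℕ; zero; suc; _≤_)
open import Data.Fin using (Fin)
open import Data.List using (List; []; _∷_)
open import Data.List.Membership.Propositional using (_∈_; _∉_)
open import Data.List.Relation.Unary.Unique.Propositional using (Unique)
open import Data.Product using (Σ; _×_; ∃)

data Path {n : ℕ} (E : Fin n → Fin n → Set) : Fin n → Fin n → Set where
  here : (x : Fin n) → Path E x x
  step : {x y z : Fin n} → E x y → Path E y z → Path E x z

verts : {n : ℕ} {E : Fin n → Fin n → Set} {x y : Fin n} → Path E x y → List (Fin n)
verts (here x) = x ∷ []
verts (step {x = x} _ p) = x ∷ verts p

len : {n : ℕ} {E : Fin n → Fin n → Set} {x y : Fin n} → Path E x y → ℕ
len (here _) = zero
len (step _ p) = suc (len p)

Simple : {n : ℕ} {E : Fin n → Fin n → Set} {x y : Fin n} → Path E x y → Set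
Simple p = Unique (verts p)

InPstar : {n : ℕ} (E : Fin n → Fin n → Set) (l : ℕ) {x y : Fin n} → Path E x y → Set
InPstar E l p = Simple p × len p ≤ l

-- EV*_l(x,y) avoiding z "exists": some p ∈ P*_l(x,y) with z ∉ V(p)
EVExists : {n : ℕ} (E : Fin n → Fin n → Set) (l : ℕ) (x y z : Fin n) → Set
EVExists E l x y z = Σ (Path E x y) (λ p → InPstar E l p × z ∉ verts p)

InEV : {n : ℕ} (E : Fin n → Fin n → Set) (l : ℕ) (x y z : Fin n) → Fin n → Set
InEV E l x y z w = (p : Path E x y) → InPstar E l p → z ∉ verts p → w ∈ verts p

EVMeet : {n : ℕ} (E : Fin n → Fin n → Set) (l1 : ℕ) (x1 y1 z1 : Fin n)
         (l2 : ℕ) (x2 y2 z2 : Fin n) → Set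
EVMeet E l1 x1 y1 z1 l2 x2 y2 z2 = ∃ λ w → InEV E l1 x1 y1 z1 w × InEV E l2 x2 y2 z2 w

module Submission where

open import Defs
open import Data.Nat using (ℕ; _≤_; _<_; _∸_)
open import Data.Nat.Properties using (≤-trans; <⇒≤)
open import Data.Fin using (Fin)
open import Data.Product using (_×_; _,_)
open import Relation.Nullary using (¬_)
open import Relation.Binary.PropositionalEquality using (_≢_)

-- Both parts are monotonicity in the length bound: P*_l ⊆ P*_m for l ≤ m, so
-- existence propagates upwards and essential vertices propagate downwards.

module _ {n : ℕ} {E : Fin n → Fin n → Set} {l m : ℕ} (l≤m : l ≤ m) where

  InPstar-mono : {x y : Fin n} {p : Path E x y} → InPstar E l p → InPstar E m p
  InPstar-mono (simple , len≤l) = simple , ≤-trans len≤l l≤m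

  EVExists-mono : {x y z : Fin n} → EVExists E l x y z → EVExists E m x y z
  EVExists-mono (p , p∈P* , z∉p) = p , InPstar-mono p∈P* , z∉p

  InEV-antimono : {x y z w : Fin n} → InEV E m x y z w → InEV E l x y z w
  InEV-antimono w∈EV p p∈P* z∉p = w∈EV p (InPstar-mono p∈P*) z∉p

EVMeet-antimonoʳ : {n : ℕ} {E : Fin n → Fin n → Set} {l₁ l m : ℕ}
  {x₁ y₁ z₁ x y z : Fin n} → l ≤ m →
  EVMeet E l₁ x₁ y₁ z₁ m x y z → EVMeet E l₁ x₁ y₁ z₁ l x y z
EVMeet-antimonoʳ l≤m (w , w∈EV₁ , w∈EV) = w , w∈EV₁ , InEV-antimono l≤m w∈EV

theorem7 : {n : ℕ} (E : Fin n → Fin n → Set) (s t u v : Fin n) (k kf : ℕ) →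
    s ≢ t → 1 ≤ k → E u v → kf ≤ k ∸ 1 →
    ((¬ EVExists E (k ∸ kf ∸ 1) v t s →
    (l : ℕ) → l < k ∸ kf ∸ 1 → ¬ EVExists E l v t s)
    × (EVExists E (k ∸ kf ∸ 1) v t s → EVExists E kf s u t →
    EVMeet E kf s u t (k ∸ kf ∸ 1) v t s →
    (l : ℕ) → l < k ∸ kf ∸ 1 → EVExists E l v t s →
    EVMeet E kf s u t l v t s))
theorem7 E s t u v k kf _ _ _ _ =
    (λ ¬exists l l<kb exists → ¬exists (EVExists-mono (<⇒≤ l<kb) exists))
  , (λ _ _ meet l l<kb _ → EVMeet-antimonoʳ (<⇒≤ l<kb) meet)
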